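{- Let $G$ be the following random bipartite graph with parts $U,W$: $|U|\ge\frac23 n$ and $|W|\le n$ for an integer $n$, and every vertex of $W$ is joined to a set of $20$ vertices of $U$ chosen uniformly at random, independently for different vertices of $W$. Then with high probability every set $S\subset W$ of size $1\le s\le n/100$ satisfies $|N(S)\cap U|>8s$.
   Context: $N(S)$ denotes the set of neighbors of $S$ in $G$. "With high probability" means with probability tending to $1$ as $n\to\infty$. -}

module Defs where

open import Data.Nat using (ℕ; zero; suc; _+_; _*_; _≤ᵇ_; _≟_)
open import Data.Bool using (Bool; true; false; _∧_; if_then_else_)
open import Data.List using (List; []; _∷_; [_]; map; _++_; concatMap; filter; length)
open import Data.Bool.ListAction using (any)
open import Data.Nat.ListAction using (sum)
open import Data.Vec using (Vec; []; _∷_)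
open import Data.Fin.Subset using (Subset; ∣_∣; _∪_; ⊥)

subsets : (n : ℕ) → List (Subset n)
subsets zero = [ [] ]
subsets (suc n) = map (true ∷_) (subsets n) ++ map (false ∷_) (subsets n)

kSubsets : (n k : ℕ) → List (Subset n)
kSubsets n k = filter (λ s → ∣ s ∣ ≟ k) (subsets n)

-- sample space: each vertex of W = Fin w picks a 20-subset of U = Fin u;
-- every list entry is one equally likely outcome (uniform, independent choices)
configs : (u w : ℕ) → List (Vec (Subset u) w)
configs u zero = [ [] ]
configs u (suc w) = concatMap (λ A → map (A ∷_) (configs u w)) (kSubsets u 20)

nbhd : {u w : ℕ} → Vec (Subset u) w → Subset w → Subset u
nbhd [] [] = ⊥
nbhd (A ∷ c) (true ∷ S) = A ∪ nbhd c S
nbhd (A ∷ c) (false ∷ S) = nbhd c S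

-- bad event: some S ⊆ W with 1 ≤ |S| ≤ n/100 (i.e. 100|S| ≤ n) and |N(S) ∩ U| ≤ 8|S|
isBad : {u w : ℕ} → ℕ → Vec (Subset u) w → Bool
isBad {w = w} n c =
  any (λ S → (1 ≤ᵇ ∣ S ∣) ∧ ((100 * ∣ S ∣ ≤ᵇ n) ∧ (∣ nbhd c S ∣ ≤ᵇ 8 * ∣ S ∣))) (subsets w)

badCount : (u w n : ℕ) → ℕ
badCount u w n = sum (map (λ c → if isBad n c then 1 else 0) (configs u w))

module Submission where

-- The first-moment method, carried out by exact counting on the finite
-- sample space  configs u w  (every configuration is equally likely).
--
-- A bad configuration c has a witness S ⊆ W, s = |S|, 1 ≤ s, 100 s ≤ n,
-- whose neighbourhood lies inside some T ⊆ U with |T| ≤ m = 8s.  For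
-- fixed S and T the configurations with N(S) ⊆ T number exactly
-- C(|T|,20)^s · C(u,20)^(w-s), and C(t,20)/C(u,20) ≤ (t/u)^20.  Hence
--   #bad ≤ Σ_s C(w,s) · #{T : |T| ≤ 8s} · (8s/u)^(20s) · #configs.
-- With C(w,s) ≤ n^s/s!, #{T : |T| ≤ m} ≤ (u+m)^m/m!, k^k ≤ 3^k k!,
-- u ≥ 2n/3 and s ≤ n/100, the s-th term is at most (A₀ s^11/(B₀ n^11))^s
-- for explicit constants A₀, B₀, and this is at most 1/(K(n+1)) as soon
-- as n ≥ (2KA₀)^3.  Summing over the at most n+1 sizes s gives
-- #bad · K ≤ #configs.  Since there are no rationals, every quotient is
-- cross-multiplied.

open import Data.Nat using (ℕ; zero; suc; _+_; _*_; _^_; _≤_; _<_; _≤ᵇ_; _≡ᵇ_; z≤n; s≤s; z<s; _!; >-nonZero)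
open import Data.Nat.Properties
open import Data.Nat.Combinatorics using (_C_; nC1≡n; nCk+nC[k+1]≡[n+1]C[k+1])
open import Data.Nat.Tactic.RingSolver using (solve-∀)
open import Data.Bool using (Bool; true; false; T; _∧_; if_then_else_)
open import Data.List using (List; []; _∷_; map; _++_; concatMap; filter; length; upTo)
open import Data.List.Properties using (length-upTo; map-++; map-∘; map-cong)
open import Data.List.Membership.Propositional using (_∈_)
open import Data.List.Membership.Propositional.Properties using (∈-map⁺; ∈-++⁺ˡ; ∈-++⁺ʳ; ∈-upTo⁺)
open import Data.List.Relation.Unary.Any using (here; there)
open import Data.Bool.ListAction using (any)
open import Data.Nat.ListAction using (sum)
open import Data.Nat.ListAction.Properties using (sum-++)
open import Data.Vec using (Vec; []; _∷_)
open import Data.Fin.Subset using (Subset; ∣_∣; _∪_; ⊥; ⊤)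
open import Data.Fin.Subset.Properties using (∣p∣≤n; ∣⊤∣≡n)
open import Data.Product using (∃-syntax; _,_; _×_; proj₁)
open import Data.Empty using (⊥-elim)
open import Data.Bool.Properties using (T-∧)
open import Function.Bundles using (Equivalence)
open import Relation.Nullary.Decidable using (_×-dec_)
open import Relation.Nullary using (Dec; does; yes; no; ¬_)
open import Relation.Binary.PropositionalEquality
open import Defs

∑ : {A : Set} → List A → (A → ℕ) → ℕ
∑ L f = sum (map f L)

syntax ∑ L (λ x → e) = ∑[ x ∈ L ] e

𝟙 : Bool → ℕ
𝟙 b = if b then 1 else 0

private
  variable
    A B : Set

∑-++ : (L₁ L₂ : List A) (f : A → ℕ) → ∑ (L₁ ++ L₂) f ≡ ∑ L₁ f + ∑ L₂ f
∑-++ L₁ L₂ f = trans (cong sum (map-++ f L₁ L₂)) (sum-++ (map f L₁) (map f L₂))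

∑-map : (g : A → B) (L : List A) (f : B → ℕ) → ∑ (map g L) f ≡ ∑[ x ∈ L ] f (g x)
∑-map g L f = cong sum (sym (map-∘ L))

∑-cong : (L : List A) {f g : A → ℕ} → (∀ x → f x ≡ g x) → ∑ L f ≡ ∑ L g
∑-cong L e = cong sum (map-cong e L)

∑-mono : (L : List A) {f g : A → ℕ} → (∀ x → f x ≤ g x) → ∑ L f ≤ ∑ L g
∑-mono [] le = z≤n
∑-mono (x ∷ L) le = +-mono-≤ (le x) (∑-mono L le)

∑-concatMap : (g : A → List B) (L : List A) (f : B → ℕ) →
  ∑ (concatMap g L) f ≡ ∑[ x ∈ L ] ∑ (g x) f
∑-concatMap g [] f = refl
∑-concatMap g (x ∷ L) f = trans (∑-++ (g x) (concatMap g L) f) (cong (∑ (g x) f +_) (∑-concatMap g L f))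

∑-zero : (L : List A) → ∑[ x ∈ L ] 0 ≡ 0
∑-zero [] = refl
∑-zero (x ∷ L) = ∑-zero L

∑-+ : (L : List A) (f g : A → ℕ) → ∑[ x ∈ L ] (f x + g x) ≡ ∑ L f + ∑ L g
∑-+ [] f g = refl
∑-+ (x ∷ L) f g = trans (cong (f x + g x +_) (∑-+ L f g)) (interchange (f x) (g x) (∑ L f) (∑ L g))
  where
  interchange : ∀ a b c d → (a + b) + (c + d) ≡ (a + c) + (b + d)
  interchange = solve-∀

∑-*ˡ : (L : List A) (k : ℕ) (f : A → ℕ) → ∑[ x ∈ L ] (k * f x) ≡ k * ∑ L f
∑-*ˡ [] k f = sym (*-zeroʳ k)
∑-*ˡ (x ∷ L) k f = trans (cong (k * f x +_) (∑-*ˡ L k f)) (sym (*-distribˡ-+ k (f x) (∑ L f)))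

∑-*ʳ : (L : List A) (k : ℕ) (f : A → ℕ) → ∑[ x ∈ L ] (f x * k) ≡ ∑ L f * k
∑-*ʳ L k f = trans (∑-cong L (λ x → *-comm (f x) k)) (trans (∑-*ˡ L k f) (*-comm k (∑ L f)))

∑-swap : (L₁ : List A) (L₂ : List B) (g : A → B → ℕ) →
  ∑[ x ∈ L₁ ] ∑ L₂ (g x) ≡ ∑[ y ∈ L₂ ] ∑[ x ∈ L₁ ] g x y
∑-swap [] L₂ g = sym (∑-zero L₂)
∑-swap (x ∷ L₁) L₂ g =
  trans (cong (∑ L₂ (g x) +_) (∑-swap L₁ L₂ g)) (sym (∑-+ L₂ (g x) (λ y → ∑[ x' ∈ L₁ ] g x' y)))

∑-filter : {P : A → Set} (P? : (x : A) → Dec (P x)) (L : List A) (f : A → ℕ) →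
  ∑ (filter P? L) f ≡ ∑[ x ∈ L ] (𝟙 (does (P? x)) * f x)
∑-filter P? [] f = refl
∑-filter P? (x ∷ L) f with does (P? x)
... | true = cong₂ _+_ (sym (+-identityʳ (f x))) (∑-filter P? L f)
... | false = ∑-filter P? L f

∑-const : (L : List A) (b : ℕ) → ∑[ x ∈ L ] b ≡ length L * b
∑-const [] b = refl
∑-const (x ∷ L) b = cong (b +_) (∑-const L b)

length≡∑1 : (L : List A) → length L ≡ ∑[ x ∈ L ] 1
length≡∑1 L = sym (trans (∑-const L 1) (*-identityʳ (length L)))

term≤∑ : {L : List A} (f : A → ℕ) {x : A} → x ∈ L → f x ≤ ∑ L f
term≤∑ f (here refl) = m≤m+n _ _
term≤∑ {L = y ∷ L} f (there x∈L) = ≤-trans (term≤∑ f x∈L) (m≤n+m _ (f y))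

𝟙-any≤∑ : (p : A → Bool) (L : List A) → 𝟙 (any p L) ≤ ∑[ x ∈ L ] 𝟙 (p x)
𝟙-any≤∑ p [] = z≤n
𝟙-any≤∑ p (x ∷ L) with p x
... | true = s≤s z≤n
... | false = 𝟙-any≤∑ p L

∑-product : (L₁ : List A) (L₂ : List B) (f : A → ℕ) (g : B → ℕ) →
  ∑[ x ∈ L₁ ] ∑[ y ∈ L₂ ] (f x * g y) ≡ ∑ L₁ f * ∑ L₂ g
∑-product L₁ L₂ f g = trans (∑-cong L₁ (λ x → ∑-*ˡ L₂ (f x) g)) (∑-*ʳ L₁ (∑ L₂ g) f)

𝟙-∧ : ∀ a b → 𝟙 (a ∧ b) ≡ 𝟙 a * 𝟙 b
𝟙-∧ true b = sym (+-identityʳ (𝟙 b))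
𝟙-∧ false b = refl

𝟙-∧ʳ : ∀ a b → 𝟙 (a ∧ b) ≤ 𝟙 b
𝟙-∧ʳ true b = ≤-refl
𝟙-∧ʳ false b = z≤n

𝟙-true : ∀ {b} → T b → 𝟙 b ≡ 1
𝟙-true {true} _ = refl

𝟙-false : ∀ {b} → ¬ T b → 𝟙 b ≡ 0
𝟙-false {true} ¬t = ⊥-elim (¬t _)
𝟙-false {false} _ = refl

guarded-mono : (b : Bool) {x y : ℕ} → (T b → x ≤ y) → 𝟙 b * x ≤ 𝟙 b * y
guarded-mono true x≤y = +-monoˡ-≤ 0 (x≤y _)
guarded-mono false x≤y = z≤n

∈-subsets : {n : ℕ} (X : Subset n) → X ∈ subsets n
∈-subsets [] = here refl
∈-subsets (true ∷ X) = ∈-++⁺ˡ (∈-map⁺ (true ∷_) (∈-subsets X))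
∈-subsets {suc n} (false ∷ X) = ∈-++⁺ʳ (map (true ∷_) (subsets n)) (∈-map⁺ (false ∷_) (∈-subsets X))

∑-subsets-suc : (u : ℕ) (f : Subset (suc u) → ℕ) →
  ∑ (subsets (suc u)) f ≡ ∑[ Y ∈ subsets u ] f (true ∷ Y) + ∑[ Y ∈ subsets u ] f (false ∷ Y)
∑-subsets-suc u f = trans (∑-++ (map (true ∷_) (subsets u)) _ f)
  (cong₂ _+_ (∑-map (true ∷_) (subsets u) f) (∑-map (false ∷_) (subsets u) f))

_⊆ᵇ_ : {n : ℕ} → Subset n → Subset n → Bool
[] ⊆ᵇ [] = true
(true ∷ A) ⊆ᵇ (y ∷ T) = y ∧ (A ⊆ᵇ T)
(false ∷ A) ⊆ᵇ (y ∷ T) = A ⊆ᵇ T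

∪-⊆ᵇ : {n : ℕ} (A B T : Subset n) → (A ∪ B) ⊆ᵇ T ≡ (A ⊆ᵇ T) ∧ (B ⊆ᵇ T)
∪-⊆ᵇ [] [] [] = refl
∪-⊆ᵇ (true ∷ A) (b ∷ B) (false ∷ T) = refl
∪-⊆ᵇ (true ∷ A) (true ∷ B) (true ∷ T) = ∪-⊆ᵇ A B T
∪-⊆ᵇ (true ∷ A) (false ∷ B) (true ∷ T) = ∪-⊆ᵇ A B T
∪-⊆ᵇ (false ∷ A) (true ∷ B) (false ∷ T) with A ⊆ᵇ T
... | true = refl
... | false = refl
∪-⊆ᵇ (false ∷ A) (true ∷ B) (true ∷ T) = ∪-⊆ᵇ A B T
∪-⊆ᵇ (false ∷ A) (false ∷ B) (y ∷ T) = ∪-⊆ᵇ A B T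

⊆ᵇ-refl : {n : ℕ} (A : Subset n) → A ⊆ᵇ A ≡ true
⊆ᵇ-refl [] = refl
⊆ᵇ-refl (true ∷ A) = ⊆ᵇ-refl A
⊆ᵇ-refl (false ∷ A) = ⊆ᵇ-refl A

⊥-⊆ᵇ : {n : ℕ} (T : Subset n) → ⊥ ⊆ᵇ T ≡ true
⊥-⊆ᵇ [] = refl
⊥-⊆ᵇ (y ∷ T) = ⊥-⊆ᵇ T

⊆ᵇ-⊤ : {n : ℕ} (A : Subset n) → A ⊆ᵇ ⊤ ≡ true
⊆ᵇ-⊤ [] = refl
⊆ᵇ-⊤ (true ∷ A) = ⊆ᵇ-⊤ A
⊆ᵇ-⊤ (false ∷ A) = ⊆ᵇ-⊤ A

-- A set T has exactly |T| C k subsets of size k (Pascal's rule in the induction).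
count-⊆ : (u : ℕ) (T : Subset u) (k : ℕ) →
  ∑[ A ∈ subsets u ] (𝟙 (∣ A ∣ ≡ᵇ k) * 𝟙 (A ⊆ᵇ T)) ≡ ∣ T ∣ C k
count-⊆ zero [] zero = refl
count-⊆ zero [] (suc k) = refl
count-⊆ (suc u) (t ∷ T) zero =
  trans (∑-subsets-suc u _) (cong₂ _+_ (∑-zero (subsets u)) (count-⊆ u T zero))
count-⊆ (suc u) (true ∷ T) (suc k) =
  trans (∑-subsets-suc u _) (trans (cong₂ _+_ (count-⊆ u T k) (count-⊆ u T (suc k)))
    (nCk+nC[k+1]≡[n+1]C[k+1] ∣ T ∣ k))
count-⊆ (suc u) (false ∷ T) (suc k) = trans (∑-subsets-suc u _)
  (cong₂ _+_ (trans (∑-cong (subsets u) (λ Y → *-zeroʳ (𝟙 (∣ Y ∣ ≡ᵇ k)))) (∑-zero (subsets u)))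
    (count-⊆ u T (suc k)))

count-size : (u k : ℕ) → ∑[ A ∈ subsets u ] 𝟙 (∣ A ∣ ≡ᵇ k) ≡ u C k
count-size u k = begin
  ∑[ A ∈ subsets u ] 𝟙 (∣ A ∣ ≡ᵇ k)
    ≡⟨ ∑-cong (subsets u) (λ A → trans (cong (λ b → 𝟙 (∣ A ∣ ≡ᵇ k) * 𝟙 b) (⊆ᵇ-⊤ A)) (*-identityʳ _)) ⟨
  ∑[ A ∈ subsets u ] (𝟙 (∣ A ∣ ≡ᵇ k) * 𝟙 (A ⊆ᵇ ⊤))
    ≡⟨ count-⊆ u ⊤ k ⟩
  ∣ ⊤ {u} ∣ C k
    ≡⟨ cong (_C k) (∣⊤∣≡n u) ⟩
  u C k ∎
  where open ≡-Reasoning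

∑-kSubsets : (u k : ℕ) (f : Subset u → ℕ) →
  ∑ (kSubsets u k) f ≡ ∑[ A ∈ subsets u ] (𝟙 (∣ A ∣ ≡ᵇ k) * f A)
∑-kSubsets u k f = ∑-filter _ (subsets u) f

kSubsets-⊆ : (u k : ℕ) (T : Subset u) → ∑[ A ∈ kSubsets u k ] 𝟙 (A ⊆ᵇ T) ≡ ∣ T ∣ C k
kSubsets-⊆ u k T = trans (∑-kSubsets u k _) (count-⊆ u T k)

#kSubsets : (u k : ℕ) → ∑[ A ∈ kSubsets u k ] 1 ≡ u C k
#kSubsets u k = trans (∑-kSubsets u k _) (trans (∑-cong (subsets u) (λ A → *-identityʳ _)) (count-size u k))

∑-configs-suc : (u w : ℕ) (f : Vec (Subset u) (suc w) → ℕ) →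
  ∑ (configs u (suc w)) f ≡ ∑[ A ∈ kSubsets u 20 ] ∑[ c ∈ configs u w ] f (A ∷ c)
∑-configs-suc u w f = trans (∑-concatMap (λ A → map (A ∷_) (configs u w)) (kSubsets u 20) f)
  (∑-cong (kSubsets u 20) (λ A → ∑-map (A ∷_) (configs u w) f))

weight : ℕ → ℕ → {w : ℕ} → Subset w → ℕ
weight a b [] = 1
weight a b (true ∷ S) = a * weight a b S
weight a b (false ∷ S) = b * weight a b S

#configs : (u w : ℕ) → ∑[ c ∈ configs u w ] 1 ≡ (u C 20) ^ w
#configs u zero = refl
#configs u (suc w) = begin
  ∑[ c ∈ configs u (suc w) ] 1                              ≡⟨ ∑-configs-suc u w _ ⟩
  ∑[ A ∈ kSubsets u 20 ] ∑[ c ∈ configs u w ] (1 * 1)      ≡⟨ ∑-product (kSubsets u 20) (configs u w) _ _ ⟩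
  ∑[ A ∈ kSubsets u 20 ] 1 * ∑[ c ∈ configs u w ] 1        ≡⟨ cong₂ _*_ (#kSubsets u 20) (#configs u w) ⟩
  (u C 20) * (u C 20) ^ w ∎
  where open ≡-Reasoning

-- Exactly weight (|T| C 20) (u C 20) S configurations have N(S) ⊆ T:
-- each vertex of S must choose inside T, the others are free.
#nbhd-⊆ : (u w : ℕ) (T : Subset u) (S : Subset w) →
  ∑[ c ∈ configs u w ] 𝟙 (nbhd c S ⊆ᵇ T) ≡ weight (∣ T ∣ C 20) (u C 20) S
#nbhd-⊆ u zero T [] = cong (λ b → 𝟙 b + 0) (⊥-⊆ᵇ T)
#nbhd-⊆ u (suc w) T (true ∷ S) = begin
  ∑[ c ∈ configs u (suc w) ] 𝟙 (nbhd c (true ∷ S) ⊆ᵇ T)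
    ≡⟨ ∑-configs-suc u w _ ⟩
  ∑[ A ∈ kSubsets u 20 ] ∑[ c ∈ configs u w ] 𝟙 ((A ∪ nbhd c S) ⊆ᵇ T)
    ≡⟨ ∑-cong (kSubsets u 20) (λ A → ∑-cong (configs u w) (λ c →
         trans (cong 𝟙 (∪-⊆ᵇ A (nbhd c S) T)) (𝟙-∧ (A ⊆ᵇ T) _))) ⟩
  ∑[ A ∈ kSubsets u 20 ] ∑[ c ∈ configs u w ] (𝟙 (A ⊆ᵇ T) * 𝟙 (nbhd c S ⊆ᵇ T))
    ≡⟨ ∑-product (kSubsets u 20) (configs u w) _ _ ⟩
  ∑[ A ∈ kSubsets u 20 ] 𝟙 (A ⊆ᵇ T) * ∑[ c ∈ configs u w ] 𝟙 (nbhd c S ⊆ᵇ T)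
    ≡⟨ cong₂ _*_ (kSubsets-⊆ u 20 T) (#nbhd-⊆ u w T S) ⟩
  (∣ T ∣ C 20) * weight (∣ T ∣ C 20) (u C 20) S ∎
  where open ≡-Reasoning
#nbhd-⊆ u (suc w) T (false ∷ S) = begin
  ∑[ c ∈ configs u (suc w) ] 𝟙 (nbhd c (false ∷ S) ⊆ᵇ T)
    ≡⟨ ∑-configs-suc u w _ ⟩
  ∑[ A ∈ kSubsets u 20 ] ∑[ c ∈ configs u w ] 𝟙 (nbhd c S ⊆ᵇ T)
    ≡⟨ ∑-cong (kSubsets u 20) (λ A → ∑-cong (configs u w) (λ c → sym (*-identityˡ _))) ⟩
  ∑[ A ∈ kSubsets u 20 ] ∑[ c ∈ configs u w ] (1 * 𝟙 (nbhd c S ⊆ᵇ T))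
    ≡⟨ ∑-product (kSubsets u 20) (configs u w) _ _ ⟩
  ∑[ A ∈ kSubsets u 20 ] 1 * ∑[ c ∈ configs u w ] 𝟙 (nbhd c S ⊆ᵇ T)
    ≡⟨ cong₂ _*_ (#kSubsets u 20) (#nbhd-⊆ u w T S) ⟩
  (u C 20) * weight (∣ T ∣ C 20) (u C 20) S ∎
  where open ≡-Reasoning

weight-bound : (a b x y : ℕ) {w : ℕ} (S : Subset w) → a * y ≤ b * x →
  weight a b S * y ^ ∣ S ∣ ≤ b ^ w * x ^ ∣ S ∣
weight-bound a b x y [] ay≤bx = ≤-refl
weight-bound a b x y {suc w} (true ∷ S) ay≤bx = begin
  a * weight a b S * (y * y ^ ∣ S ∣)    ≡⟨ regroup a (weight a b S) y (y ^ ∣ S ∣) ⟩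
  (a * y) * (weight a b S * y ^ ∣ S ∣)  ≤⟨ *-mono-≤ ay≤bx (weight-bound a b x y S ay≤bx) ⟩
  (b * x) * (b ^ w * x ^ ∣ S ∣)         ≡⟨ regroup b x (b ^ w) (x ^ ∣ S ∣) ⟩
  b * b ^ w * (x * x ^ ∣ S ∣)           ∎
  where
  open ≤-Reasoning
  regroup : ∀ p q r t → p * q * (r * t) ≡ (p * r) * (q * t)
  regroup = solve-∀
weight-bound a b x y {suc w} (false ∷ S) ay≤bx = begin
  b * weight a b S * y ^ ∣ S ∣    ≡⟨ *-assoc b _ _ ⟩
  b * (weight a b S * y ^ ∣ S ∣)  ≤⟨ *-monoʳ-≤ b (weight-bound a b x y S ay≤bx) ⟩
  b * (b ^ w * x ^ ∣ S ∣)         ≡⟨ *-assoc b _ _ ⟨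
  b * b ^ w * x ^ ∣ S ∣           ∎
  where open ≤-Reasoning

[m*n]^k≡m^k*n^k : ∀ m n k → (m * n) ^ k ≡ m ^ k * n ^ k
[m*n]^k≡m^k*n^k m n zero = refl
[m*n]^k≡m^k*n^k m n (suc k) = trans (cong (m * n *_) ([m*n]^k≡m^k*n^k m n k)) (interchange m n (m ^ k) (n ^ k))
  where
  interchange : ∀ a b c d → a * b * (c * d) ≡ a * c * (b * d)
  interchange = solve-∀

^>0 : ∀ {m} k → 0 < m → 0 < m ^ k
^>0 {m} k 0<m = m^n>0 m {{>-nonZero 0<m}} k

*-cancelʳ-≤-pos : ∀ m n o → 0 < o → m * o ≤ n * o → m ≤ n
*-cancelʳ-≤-pos m n o 0<o = *-cancelʳ-≤ m n o {{>-nonZero 0<o}}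

absorption : ∀ n k → (suc n C suc k) * suc k ≡ suc n * (n C k)
absorption n zero = trans (*-identityʳ _) (trans (nC1≡n (suc n)) (sym (*-identityʳ (suc n))))
absorption zero (suc k) = refl
absorption (suc n) (suc k) = begin
  (suc (suc n) C suc (suc k)) * suc (suc k)
    ≡⟨ cong (_* suc (suc k)) (pascal (suc n) (suc k)) ⟨
  (P′ + R′) * suc (suc k)
    ≡⟨ expand P′ R′ k ⟩
  P′ * suc k + P′ + R′ * suc (suc k)
    ≡⟨ cong₂ (λ x y → x + P′ + y) (absorption n k) (absorption n (suc k)) ⟩
  suc n * (n C k) + P′ + suc n * (n C suc k)
    ≡⟨ collect (suc n) (n C k) P′ (n C suc k) ⟩
  P′ + suc n * ((n C k) + (n C suc k))
    ≡⟨ cong (λ x → P′ + suc n * x) (pascal n k) ⟩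
  P′ + suc n * P′ ∎
  where
  open ≡-Reasoning
  pascal : ∀ n k → (n C k) + (n C suc k) ≡ suc n C suc k
  pascal = nCk+nC[k+1]≡[n+1]C[k+1]
  P′ R′ : ℕ
  P′ = suc n C suc k
  R′ = suc n C suc (suc k)
  expand : ∀ a b k → (a + b) * suc (suc k) ≡ a * suc k + a + b * suc (suc k)
  expand = solve-∀
  collect : ∀ m p a r → m * p + a + m * r ≡ a + m * (p + r)
  collect = solve-∀

-- The key step of the ratio bound: for t ≤ u, (u+1)/(t+1) ≤ u/t, so the
-- inequality  C(t,k)/C(u,k) ≤ (t/u)^k  survives replacing u, t by u+1, t+1
-- in the powers.
C-ratio-shift : ∀ k t u → t ≤ u → (t C k) * u ^ k ≤ (u C k) * t ^ k →
  (t C k) * suc u ^ k ≤ (u C k) * suc t ^ k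
C-ratio-shift k zero zero t≤u ih = ≤-refl
C-ratio-shift k t (suc u) t≤u ih = *-cancelʳ-≤-pos _ _ (suc u ^ k) (^>0 k z<s) (begin
  (t C k) * suc (suc u) ^ k * suc u ^ k     ≡⟨ swap₂₃ (t C k) (suc (suc u) ^ k) (suc u ^ k) ⟩
  (t C k) * suc u ^ k * suc (suc u) ^ k     ≤⟨ *-monoˡ-≤ (suc (suc u) ^ k) ih ⟩
  (U C k) * t ^ k * suc (suc u) ^ k         ≡⟨ *-assoc (U C k) (t ^ k) _ ⟩
  (U C k) * (t ^ k * suc (suc u) ^ k)       ≡⟨ cong ((U C k) *_) ([m*n]^k≡m^k*n^k t (suc (suc u)) k) ⟨
  (U C k) * (t * suc (suc u)) ^ k           ≤⟨ *-monoʳ-≤ (U C k) (^-monoˡ-≤ k cross) ⟩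
  (U C k) * (suc t * U) ^ k                 ≡⟨ cong ((U C k) *_) ([m*n]^k≡m^k*n^k (suc t) U k) ⟩
  (U C k) * (suc t ^ k * U ^ k)             ≡⟨ *-assoc (U C k) _ _ ⟨
  (U C k) * suc t ^ k * U ^ k               ∎)
  where
  open ≤-Reasoning
  U : ℕ
  U = suc u
  swap₂₃ : ∀ a b c → a * b * c ≡ a * c * b
  swap₂₃ = solve-∀
  cross : t * suc (suc u) ≤ suc t * U
  cross = begin
    t * suc U  ≡⟨ *-suc t U ⟩
    t + t * U  ≤⟨ +-monoˡ-≤ (t * U) t≤u ⟩
    U + t * U  ∎

C-ratio : ∀ k t u → t ≤ u → (t C k) * u ^ k ≤ (u C k) * t ^ k
C-ratio zero t u t≤u = ≤-refl
C-ratio (suc k) zero u t≤u = z≤n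
C-ratio (suc k) (suc t) (suc u) (s≤s t≤u) = *-cancelʳ-≤-pos _ _ (suc k) z<s (begin
  (suc t C suc k) * (suc u * suc u ^ k) * suc k  ≡⟨ swap₂₃ (suc t C suc k) (suc u * suc u ^ k) (suc k) ⟩
  (suc t C suc k) * suc k * (suc u * suc u ^ k)  ≡⟨ cong (_* (suc u * suc u ^ k)) (absorption t k) ⟩
  suc t * (t C k) * (suc u * suc u ^ k)          ≡⟨ interchange (suc t) (t C k) (suc u) (suc u ^ k) ⟩
  suc t * suc u * ((t C k) * suc u ^ k)          ≤⟨ *-monoʳ-≤ (suc t * suc u) (C-ratio-shift k t u t≤u (C-ratio k t u t≤u)) ⟩
  suc t * suc u * ((u C k) * suc t ^ k)          ≡⟨ interchange′ (suc t) (suc u) (u C k) (suc t ^ k) ⟩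
  suc u * (u C k) * (suc t * suc t ^ k)          ≡⟨ cong (_* (suc t * suc t ^ k)) (absorption u k) ⟨
  (suc u C suc k) * suc k * (suc t * suc t ^ k)  ≡⟨ swap₂₃ (suc u C suc k) (suc t * suc t ^ k) (suc k) ⟨
  (suc u C suc k) * (suc t * suc t ^ k) * suc k  ∎)
  where
  open ≤-Reasoning
  swap₂₃ : ∀ a b c → a * b * c ≡ a * c * b
  swap₂₃ = solve-∀
  interchange : ∀ a b c d → a * b * (c * d) ≡ a * c * (b * d)
  interchange = solve-∀
  interchange′ : ∀ a b c d → a * b * (c * d) ≡ b * c * (a * d)
  interchange′ = solve-∀

C-falling : ∀ w s → (w C s) * s ! ≤ w ^ s
C-falling w zero = ≤-refl
C-falling zero (suc s) = z≤n
C-falling (suc w) (suc s) = begin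
  (suc w C suc s) * (suc s * s !)  ≡⟨ *-assoc (suc w C suc s) (suc s) (s !) ⟨
  (suc w C suc s) * suc s * s !    ≡⟨ cong (_* s !) (absorption w s) ⟩
  suc w * (w C s) * s !            ≡⟨ *-assoc (suc w) (w C s) (s !) ⟩
  suc w * ((w C s) * s !)          ≤⟨ *-monoʳ-≤ (suc w) (C-falling w s) ⟩
  suc w * w ^ s                    ≤⟨ *-monoʳ-≤ (suc w) (^-monoˡ-≤ s (n≤1+n w)) ⟩
  suc w * suc w ^ s                ∎
  where open ≤-Reasoning

bernoulli : ∀ y m → y ^ suc m + suc m * y ^ m ≤ suc y ^ suc m
bernoulli y zero = ≤-reflexive (base y)
  where
  base : ∀ y → y * 1 + 1 * 1 ≡ suc y * 1
  base = solve-∀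
bernoulli y (suc m) = begin
  y * (y * y ^ m) + suc (suc m) * (y * y ^ m)                   ≤⟨ m≤m+n _ (suc m * y ^ m) ⟩
  y * (y * y ^ m) + suc (suc m) * (y * y ^ m) + suc m * y ^ m   ≡⟨ factor y m (y ^ m) ⟩
  suc y * (y * y ^ m + suc m * y ^ m)                           ≤⟨ *-monoʳ-≤ (suc y) (bernoulli y m) ⟩
  suc y * suc y ^ suc m                                         ∎
  where
  open ≤-Reasoning
  factor : ∀ y m p → y * (y * p) + suc (suc m) * (y * p) + suc m * p ≡ suc y * (y * p + suc m * p)
  factor = solve-∀

atMost : ℕ → ℕ → ℕ
atMost u m = ∑[ T ∈ subsets u ] 𝟙 (∣ T ∣ ≤ᵇ m)

≤ᵇ-suc : ∀ x m → (suc x ≤ᵇ suc m) ≡ (x ≤ᵇ m)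
≤ᵇ-suc zero m = refl
≤ᵇ-suc (suc x) m = refl

atMost-zero : ∀ u → atMost u 0 ≤ 1
atMost-zero zero = ≤-refl
atMost-zero (suc u) = ≤-trans
  (≤-reflexive (trans (∑-subsets-suc u _) (cong (_+ atMost u 0) (∑-zero (subsets u)))))
  (atMost-zero u)

atMost-suc : ∀ u m → atMost (suc u) (suc m) ≡ atMost u m + atMost u (suc m)
atMost-suc u m = trans (∑-subsets-suc u _)
  (cong (_+ atMost u (suc m)) (∑-cong (subsets u) (λ T → cong 𝟙 (≤ᵇ-suc ∣ T ∣ m))))

m!≤m^m : ∀ m → m ! ≤ m ^ m
m!≤m^m zero = ≤-refl
m!≤m^m (suc m) = *-monoʳ-≤ (suc m) (≤-trans (m!≤m^m m) (^-monoˡ-≤ m (n≤1+n m)))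

atMost-bound : ∀ u m → atMost u m * m ! ≤ (u + m) ^ m
atMost-bound zero m = ≤-trans (≤-reflexive (+-identityʳ (m !))) (m!≤m^m m)
atMost-bound (suc u) zero = ≤-trans (≤-reflexive (*-identityʳ _)) (atMost-zero (suc u))
atMost-bound (suc u) (suc m) = begin
  atMost (suc u) (suc m) * (suc m * m !)
    ≡⟨ cong (_* (suc m * m !)) (atMost-suc u m) ⟩
  (atMost u m + atMost u (suc m)) * (suc m * m !)
    ≡⟨ distribute (atMost u m) (atMost u (suc m)) (suc m) (m !) ⟩
  suc m * (atMost u m * m !) + atMost u (suc m) * (suc m * m !)
    ≤⟨ +-mono-≤ (*-monoʳ-≤ (suc m) (atMost-bound u m)) (atMost-bound u (suc m)) ⟩
  suc m * (u + m) ^ m + (u + suc m) ^ suc m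
    ≡⟨ cong (λ z → suc m * (u + m) ^ m + z ^ suc m) (+-suc u m) ⟩
  suc m * (u + m) ^ m + suc (u + m) ^ suc m
    ≤⟨ +-monoˡ-≤ _ (*-monoʳ-≤ (suc m) (^-monoˡ-≤ m (n≤1+n (u + m)))) ⟩
  suc m * suc (u + m) ^ m + suc (u + m) ^ suc m
    ≡⟨ +-comm (suc m * suc (u + m) ^ m) (suc (u + m) ^ suc m) ⟩
  suc (u + m) ^ suc m + suc m * suc (u + m) ^ m
    ≤⟨ bernoulli (suc (u + m)) m ⟩
  suc (suc (u + m)) ^ suc m
    ≡⟨ cong (λ z → suc z ^ suc m) (+-suc u m) ⟨
  (suc u + suc m) ^ suc m ∎
  where
  open ≤-Reasoning
  distribute : ∀ a b m f → (a + b) * (m * f) ≡ m * (a * f) + b * (m * f)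
  distribute = solve-∀

small-power : ∀ s j → j ≤ s → suc s ^ j * (s * s) ≤ s ^ j * (s * s + j * s + j * j)
small-power s zero j≤s = ≤-reflexive (base s)
  where
  base : ∀ s → 1 * (s * s) ≡ 1 * (s * s + 0 * s + 0 * 0)
  base = solve-∀
small-power s (suc j) j≤s = begin
  suc s * suc s ^ j * (s * s)
    ≡⟨ *-assoc (suc s) (suc s ^ j) (s * s) ⟩
  suc s * (suc s ^ j * (s * s))
    ≤⟨ *-monoʳ-≤ (suc s) (small-power s j (≤-trans (n≤1+n j) j≤s)) ⟩
  suc s * (s ^ j * (s * s + j * s + j * j))
    ≡⟨ expand s j (s ^ j) ⟩
  s ^ j * (s * s * s + suc j * (s * s) + j * j * s + j * s + j * j)
    ≤⟨ *-monoʳ-≤ (s ^ j) (+-monoʳ-≤ _ (*-monoʳ-≤ j (≤-trans (n≤1+n j) j≤s))) ⟩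
  s ^ j * (s * s * s + suc j * (s * s) + j * j * s + j * s + j * s)
    ≤⟨ *-monoʳ-≤ (s ^ j) (m≤m+n _ s) ⟩
  s ^ j * (s * s * s + suc j * (s * s) + j * j * s + j * s + j * s + s)
    ≡⟨ collect s j (s ^ j) ⟩
  s * s ^ j * (s * s + suc j * s + suc j * suc j) ∎
  where
  open ≤-Reasoning
  expand : ∀ s j p → suc s * (p * (s * s + j * s + j * j)) ≡
    p * (s * s * s + suc j * (s * s) + j * j * s + j * s + j * j)
  expand = solve-∀
  collect : ∀ s j p → p * (s * s * s + suc j * (s * s) + j * j * s + j * s + j * s + s) ≡
    s * p * (s * s + suc j * s + suc j * suc j)
  collect = solve-∀

[1+s]^s≤3s^s : ∀ s → suc s ^ s ≤ 3 * s ^ s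
[1+s]^s≤3s^s zero = s≤s z≤n
[1+s]^s≤3s^s s@(suc _) = *-cancelʳ-≤-pos _ _ (s * s) z<s (begin
  suc s ^ s * (s * s)              ≤⟨ small-power s s ≤-refl ⟩
  s ^ s * (s * s + s * s + s * s)  ≡⟨ triple (s ^ s) (s * s) ⟩
  3 * s ^ s * (s * s)              ∎)
  where
  open ≤-Reasoning
  triple : ∀ p q → p * (q + q + q) ≡ 3 * p * q
  triple = solve-∀

s^s≤3^s*s! : ∀ s → s ^ s ≤ 3 ^ s * s !
s^s≤3^s*s! zero = ≤-refl
s^s≤3^s*s! (suc s) = begin
  suc s * suc s ^ s          ≤⟨ *-monoʳ-≤ (suc s) ([1+s]^s≤3s^s s) ⟩
  suc s * (3 * s ^ s)        ≤⟨ *-monoʳ-≤ (suc s) (*-monoʳ-≤ 3 (s^s≤3^s*s! s)) ⟩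
  suc s * (3 * (3 ^ s * s !)) ≡⟨ regroup (suc s) (3 ^ s) (s !) ⟩
  3 * 3 ^ s * (suc s * s !)  ∎
  where
  open ≤-Reasoning
  regroup : ∀ a p f → a * (3 * (p * f)) ≡ 3 * p * (a * f)
  regroup = solve-∀

scale-powers : ∀ k X Y x y s → 0 < y → X * y ≤ Y * x → k * x ^ s ≤ y ^ s → k * X ^ s ≤ Y ^ s
scale-powers k X Y x y s 0<y Xy≤Yx kx≤y = *-cancelʳ-≤-pos _ _ (y ^ s) (^>0 s 0<y) (begin
  k * X ^ s * y ^ s    ≡⟨ *-assoc k (X ^ s) (y ^ s) ⟩
  k * (X ^ s * y ^ s)  ≡⟨ cong (k *_) ([m*n]^k≡m^k*n^k X y s) ⟨
  k * (X * y) ^ s      ≤⟨ *-monoʳ-≤ k (^-monoˡ-≤ s Xy≤Yx) ⟩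
  k * (Y * x) ^ s      ≡⟨ cong (k *_) ([m*n]^k≡m^k*n^k Y x s) ⟩
  k * (Y ^ s * x ^ s)  ≡⟨ swap-front k (Y ^ s) (x ^ s) ⟩
  Y ^ s * (k * x ^ s)  ≤⟨ *-monoʳ-≤ (Y ^ s) kx≤y ⟩
  Y ^ s * y ^ s        ∎)
  where
  open ≤-Reasoning
  swap-front : ∀ a b c → a * (b * c) ≡ b * (a * c)
  swap-front = solve-∀

-- If x/y ≤ 1/r and k x/y ≤ r^j, then k (x/y)^(j+1) ≤ 1: one factor x/y
-- absorbs k at the price r^j, which the other j factors pay back.
geometric : ∀ k x y r j → r * x ≤ y → k * x ≤ y * r ^ j → k * x ^ suc j ≤ y ^ suc j
geometric k x y r j rx≤y kx≤yr^j = begin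
  k * (x * x ^ j)      ≡⟨ *-assoc k x (x ^ j) ⟨
  k * x * x ^ j        ≤⟨ *-monoˡ-≤ (x ^ j) kx≤yr^j ⟩
  y * r ^ j * x ^ j    ≡⟨ *-assoc y (r ^ j) (x ^ j) ⟩
  y * (r ^ j * x ^ j)  ≡⟨ cong (y *_) ([m*n]^k≡m^k*n^k r x j) ⟨
  y * (r * x) ^ j      ≤⟨ *-monoʳ-≤ y (^-monoˡ-≤ j rx≤y) ⟩
  y * y ^ j            ∎
  where open ≤-Reasoning

n≤n^[1+k] : ∀ n k → n ≤ n ^ suc k
n≤n^[1+k] zero k = z≤n
n≤n^[1+k] (suc n) k = m≤m*n (suc n) (suc n ^ k) {{m^n≢0 (suc n) k}}

1+j≤2^j : ∀ j → suc j ≤ 2 ^ j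
1+j≤2^j zero = ≤-refl
1+j≤2^j (suc j) = +-mono-≤ (≤-trans (s≤s z≤n) (1+j≤2^j j)) (≤-trans (1+j≤2^j j) (≤-reflexive (sym (+-identityʳ _))))

-- If c^3 ≤ n, s ≤ n and s ≤ t, then c n s^11 ≤ n^11 t^12: either s ≥ c, and
-- c n s^11 ≤ n s^12, or s < c, and c n s^11 ≤ c^3 n^10 ≤ n^11.
linear-factor : ∀ c n s t → c ^ 3 ≤ n → s ≤ n → s ≤ t → 0 < t → c * n * s ^ 11 ≤ n ^ 11 * t ^ 12
linear-factor c n s t c³≤n s≤n s≤t 0<t with c ≤? s
... | yes c≤s = begin
  c * n * s ^ 11    ≤⟨ *-monoˡ-≤ (s ^ 11) (*-monoˡ-≤ n c≤s) ⟩
  s * n * s ^ 11    ≡⟨ regroup s n (s ^ 11) ⟩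
  n * (s * s ^ 11)  ≤⟨ *-mono-≤ (n≤n^[1+k] n 10) (^-monoˡ-≤ 12 s≤t) ⟩
  n ^ 11 * t ^ 12   ∎
  where
  open ≤-Reasoning
  regroup : ∀ a b p → a * b * p ≡ b * (a * p)
  regroup = solve-∀
... | no c≰s = begin
  c * n * s ^ 11              ≡⟨ regroup c n s (s ^ 9) ⟩
  (c * s * s) * s ^ 9 * n     ≤⟨ *-monoˡ-≤ n (*-mono-≤ (*-mono-≤ (*-monoʳ-≤ c s≤c) s≤c) (^-monoˡ-≤ 9 s≤n)) ⟩
  (c * c * c) * n ^ 9 * n     ≡⟨ cube c (n ^ 9) n ⟩
  c ^ 3 * (n ^ 9 * n)         ≤⟨ *-monoˡ-≤ (n ^ 9 * n) c³≤n ⟩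
  n * (n ^ 9 * n)             ≡⟨ power n (n ^ 9) ⟩
  n ^ 11 * 1                  ≤⟨ *-monoʳ-≤ (n ^ 11) (^>0 12 0<t) ⟩
  n ^ 11 * t ^ 12             ∎
  where
  open ≤-Reasoning
  s≤c : s ≤ c
  s≤c = ≤-trans (n≤1+n s) (≰⇒> c≰s)
  regroup : ∀ a b x p → a * b * (x * (x * p)) ≡ (a * x * x) * p * b
  regroup = solve-∀
  cube : ∀ a p q → (a * a * a) * p * q ≡ a * (a * (a * 1)) * (p * q)
  cube = solve-∀
  power : ∀ a q → a * (q * a) ≡ a * (a * q) * 1
  power = solve-∀

-- The constants of the estimate: for admissible s the s-th term is at most (A₀ s^11 / (B₀ n^11))^s.
A₀ B₀ : ℕ
A₀ = 28 ^ 8 * 8 ^ 12 * 3 ^ 21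
B₀ = 2 ^ 12 * 25 ^ 8

-- 2^12 A₀ ≤ 100^11 B₀ (checked by evaluation), so for s ≤ n/100 the ratio
-- A₀ s^11 / (B₀ n^11) is at most 2^-12.
2^12A₀≤100^11B₀ : 2 ^ 12 * A₀ ≤ B₀ * 100 ^ 11
2^12A₀≤100^11B₀ = ≤ᵇ⇒≤ (2 ^ 12 * A₀) (B₀ * 100 ^ 11) _

-- From this size of n on, the failure probability is at most 1/K.
threshold : ℕ → ℕ
threshold K = (2 * K * A₀) ^ 3

tail-estimate : ∀ K n s → 0 < s → 100 * s ≤ n → threshold K ≤ n →
  K * suc n * (A₀ * s ^ 11) ^ s ≤ (B₀ * n ^ 11) ^ s
tail-estimate K n zero () 100s≤n th≤n
tail-estimate K n s@(suc j) _ 100s≤n th≤n =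
  geometric (K * suc n) (A₀ * s ^ 11) (B₀ * n ^ 11) (2 ^ 12) j ratio first-factor
  where
  open ≤-Reasoning
  s≤n : s ≤ n
  s≤n = ≤-trans (m≤n*m s 100) 100s≤n
  ratio : 2 ^ 12 * (A₀ * s ^ 11) ≤ B₀ * n ^ 11
  ratio = begin
    2 ^ 12 * (A₀ * s ^ 11)     ≡⟨ *-assoc (2 ^ 12) A₀ (s ^ 11) ⟨
    2 ^ 12 * A₀ * s ^ 11       ≤⟨ *-monoˡ-≤ (s ^ 11) 2^12A₀≤100^11B₀ ⟩
    B₀ * 100 ^ 11 * s ^ 11     ≡⟨ *-assoc B₀ (100 ^ 11) (s ^ 11) ⟩
    B₀ * (100 ^ 11 * s ^ 11)   ≡⟨ cong (B₀ *_) ([m*n]^k≡m^k*n^k 100 s 11) ⟨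
    B₀ * (100 * s) ^ 11        ≤⟨ *-monoʳ-≤ B₀ (^-monoˡ-≤ 11 100s≤n) ⟩
    B₀ * n ^ 11                ∎
  1+n≤2n : suc n ≤ 2 * n
  1+n≤2n = begin
    suc n      ≡⟨ +-comm 1 n ⟩
    n + 1      ≤⟨ +-monoʳ-≤ n (≤-trans (s≤s z≤n) s≤n) ⟩
    n + n      ≡⟨ cong (n +_) (+-identityʳ n) ⟨
    2 * n      ∎
  swap-exponents : (2 ^ j) ^ 12 ≡ (2 ^ 12) ^ j
  swap-exponents = trans (^-*-assoc 2 j 12) (trans (cong (2 ^_) (*-comm j 12)) (sym (^-*-assoc 2 12 j)))
  first-factor : K * suc n * (A₀ * s ^ 11) ≤ B₀ * n ^ 11 * (2 ^ 12) ^ j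
  first-factor = begin
    K * suc n * (A₀ * s ^ 11)        ≤⟨ *-monoˡ-≤ (A₀ * s ^ 11) (*-monoʳ-≤ K 1+n≤2n) ⟩
    K * (2 * n) * (A₀ * s ^ 11)      ≡⟨ regroup K n A₀ (s ^ 11) ⟩
    2 * K * A₀ * n * s ^ 11          ≤⟨ linear-factor (2 * K * A₀) n s (2 ^ j) th≤n s≤n (1+j≤2^j j) (^>0 j z<s) ⟩
    n ^ 11 * (2 ^ j) ^ 12           ≡⟨ cong (n ^ 11 *_) swap-exponents ⟩
    n ^ 11 * (2 ^ 12) ^ j           ≤⟨ m≤n*m (n ^ 11 * (2 ^ 12) ^ j) B₀ ⟩
    B₀ * (n ^ 11 * (2 ^ 12) ^ j)     ≡⟨ *-assoc B₀ (n ^ 11) ((2 ^ 12) ^ j) ⟨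
    B₀ * n ^ 11 * (2 ^ 12) ^ j       ∎
    where
    regroup : ∀ k m a p → k * (2 * m) * (a * p) ≡ 2 * k * a * m * p
    regroup = solve-∀

base-inequality : ∀ u n s → 100 * s ≤ n → 2 * n ≤ 3 * u →
  (3 ^ 9 * n * (u + 8 * s) ^ 8 * (8 * s) ^ 20) * (B₀ * n ^ 11) ≤ (u ^ 20 * (s * (8 * s) ^ 8)) * (A₀ * s ^ 11)
base-inequality u n s 100s≤n 2n≤3u = begin
  (3 ^ 9 * n * P * m ^ 20) * (B₀ * n ^ 11)
    ≡⟨ cong (λ z → (3 ^ 9 * n * P * z) * (B₀ * n ^ 11)) m^20 ⟩
  (3 ^ 9 * n * P * (m ^ 8 * (8 ^ 12 * (s * s ^ 11)))) * (2 ^ 12 * 25 ^ 8 * n ^ 11)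
    ≡⟨ rearrange₁ (3 ^ 9) n P (m ^ 8) (8 ^ 12) s (s ^ 11) (2 ^ 12) (25 ^ 8) (n ^ 11) ⟩
  Z * ((25 ^ 8 * P) * (2 ^ 12 * (n * n ^ 11)))
    ≤⟨ *-monoʳ-≤ Z (*-mono-≤ room-in-U n-vs-u) ⟩
  Z * ((28 ^ 8 * u ^ 8) * (3 ^ 12 * u ^ 12))
    ≡⟨ rearrange₂ (3 ^ 9) (m ^ 8) (8 ^ 12) s (s ^ 11) (28 ^ 8) (u ^ 8) (3 ^ 12) (u ^ 12) ⟩
  (u ^ 8 * u ^ 12 * (s * m ^ 8)) * (28 ^ 8 * 8 ^ 12 * (3 ^ 9 * 3 ^ 12) * s ^ 11)
    ≡⟨ cong (λ z → (z * (s * m ^ 8)) * (A₀ * s ^ 11)) (^-distribˡ-+-* u 8 12) ⟨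
  (u ^ 20 * (s * m ^ 8)) * (A₀ * s ^ 11) ∎
  where
  open ≤-Reasoning
  m P Z : ℕ
  m = 8 * s
  P = (u + m) ^ 8
  Z = 3 ^ 9 * 8 ^ 12 * m ^ 8 * s * s ^ 11
  m^20 : m ^ 20 ≡ m ^ 8 * (8 ^ 12 * (s * s ^ 11))
  m^20 = trans (^-distribˡ-+-* m 8 12) (cong (m ^ 8 *_) ([m*n]^k≡m^k*n^k 8 s 12))
  -- u + 8s ≤ (28/25) u, because 200 s ≤ 2n ≤ 3u
  room-in-U : 25 ^ 8 * P ≤ 28 ^ 8 * u ^ 8
  room-in-U = begin
    25 ^ 8 * (u + m) ^ 8  ≡⟨ [m*n]^k≡m^k*n^k 25 (u + m) 8 ⟨
    (25 * (u + m)) ^ 8    ≤⟨ ^-monoˡ-≤ 8 (begin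
      25 * (u + m)           ≡⟨ expand u s ⟩
      25 * u + 2 * (100 * s) ≤⟨ +-monoʳ-≤ (25 * u) (≤-trans (*-monoʳ-≤ 2 100s≤n) 2n≤3u) ⟩
      25 * u + 3 * u         ≡⟨ collect u ⟩
      28 * u                 ∎) ⟩
    (28 * u) ^ 8          ≡⟨ [m*n]^k≡m^k*n^k 28 u 8 ⟩
    28 ^ 8 * u ^ 8        ∎
    where
    expand : ∀ a b → 25 * (a + 8 * b) ≡ 25 * a + 2 * (100 * b)
    expand = solve-∀
    collect : ∀ a → 25 * a + 3 * a ≡ 28 * a
    collect = solve-∀
  n-vs-u : 2 ^ 12 * n ^ 12 ≤ 3 ^ 12 * u ^ 12
  n-vs-u = begin
    2 ^ 12 * n ^ 12  ≡⟨ [m*n]^k≡m^k*n^k 2 n 12 ⟨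
    (2 * n) ^ 12     ≤⟨ ^-monoˡ-≤ 12 2n≤3u ⟩
    (3 * u) ^ 12     ≡⟨ [m*n]^k≡m^k*n^k 3 u 12 ⟩
    3 ^ 12 * u ^ 12  ∎
  rearrange₁ : ∀ t n p q e s r a b o →
    (t * n * p * (q * (e * (s * r)))) * (a * b * o) ≡ (t * e * q * s * r) * ((b * p) * (a * (n * o)))
  rearrange₁ = solve-∀
  rearrange₂ : ∀ t q e s r c v d w →
    (t * e * q * s * r) * ((c * v) * (d * w)) ≡ (v * w * (s * q)) * (c * e * (t * d) * r)
  rearrange₂ = solve-∀

-- C(w,s) · #{T : |T| ≤ m} ≤ (3^9 n (u+m)^8 / (s m^8))^s for m = 8s and w ≤ n,
-- from C(w,s) ≤ n^s/s!, #{T : |T| ≤ m} ≤ (u+m)^m/m! and k^k ≤ 3^k k!.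
combinatorial-bound : ∀ u w n s → w ≤ n →
  (w C s) * atMost u (8 * s) * (s * (8 * s) ^ 8) ^ s ≤ (3 ^ 9 * n * (u + 8 * s) ^ 8) ^ s
combinatorial-bound u w n s w≤n = begin
  (w C s) * atMost u m * (s * m ^ 8) ^ s
    ≡⟨ cong ((w C s) * atMost u m *_) (trans ([m*n]^k≡m^k*n^k s (m ^ 8) s) (cong (s ^ s *_) (^-*-assoc m 8 s))) ⟩
  (w C s) * atMost u m * (s ^ s * m ^ m)
    ≤⟨ *-monoʳ-≤ ((w C s) * atMost u m) (*-mono-≤ (s^s≤3^s*s! s) (s^s≤3^s*s! m)) ⟩
  (w C s) * atMost u m * ((3 ^ s * s !) * (3 ^ m * m !))
    ≡⟨ regroup (w C s) (atMost u m) (3 ^ s) (s !) (3 ^ m) (m !) ⟩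
  (3 ^ s * 3 ^ m) * (((w C s) * s !) * (atMost u m * m !))
    ≤⟨ *-monoʳ-≤ (3 ^ s * 3 ^ m) (*-mono-≤ (≤-trans (C-falling w s) (^-monoˡ-≤ s w≤n)) (atMost-bound u m)) ⟩
  (3 ^ s * 3 ^ m) * (n ^ s * (u + m) ^ m)
    ≡⟨ powers ⟨
  (3 ^ 9 * n * (u + m) ^ 8) ^ s ∎
  where
  open ≤-Reasoning
  m : ℕ
  m = 8 * s
  regroup : ∀ c a t f e g → c * a * ((t * f) * (e * g)) ≡ (t * e) * ((c * f) * (a * g))
  regroup = solve-∀
  powers : (3 ^ 9 * n * (u + m) ^ 8) ^ s ≡ (3 ^ s * 3 ^ m) * (n ^ s * (u + m) ^ m)
  powers = begin-equality
    (3 ^ 9 * n * (u + m) ^ 8) ^ s           ≡⟨ [m*n]^k≡m^k*n^k (3 ^ 9 * n) ((u + m) ^ 8) s ⟩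
    (3 ^ 9 * n) ^ s * ((u + m) ^ 8) ^ s     ≡⟨ cong₂ _*_ ([m*n]^k≡m^k*n^k (3 ^ 9) n s) (^-*-assoc (u + m) 8 s) ⟩
    (3 ^ 9) ^ s * n ^ s * (u + m) ^ m       ≡⟨ cong (λ z → z * n ^ s * (u + m) ^ m) (trans (^-*-assoc 3 9 s) (^-distribˡ-+-* 3 s m)) ⟩
    3 ^ s * 3 ^ m * n ^ s * (u + m) ^ m     ≡⟨ *-assoc (3 ^ s * 3 ^ m) (n ^ s) ((u + m) ^ m) ⟩
    (3 ^ s * 3 ^ m) * (n ^ s * (u + m) ^ m) ∎

term-estimate : ∀ K u w n s → 0 < s → 100 * s ≤ n → 2 * n ≤ 3 * u → w ≤ n → threshold K ≤ n →
  (w C s) * atMost u (8 * s) * ((8 * s) ^ 20) ^ s * (K * suc n) ≤ (u ^ 20) ^ s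
term-estimate K u w n s 0<s 100s≤n 2n≤3u w≤n th≤n = *-cancelʳ-≤-pos _ _ ((s * m ^ 8) ^ s) (^>0 s 0<sm⁸) (begin
  (w C s) * atMost u m * (m ^ 20) ^ s * kn * (s * m ^ 8) ^ s
    ≡⟨ regroup ((w C s) * atMost u m) ((m ^ 20) ^ s) kn ((s * m ^ 8) ^ s) ⟩
  kn * ((w C s) * atMost u m * (s * m ^ 8) ^ s * (m ^ 20) ^ s)
    ≤⟨ *-monoʳ-≤ kn (*-monoˡ-≤ ((m ^ 20) ^ s) (combinatorial-bound u w n s w≤n)) ⟩
  kn * ((3 ^ 9 * n * (u + m) ^ 8) ^ s * (m ^ 20) ^ s)
    ≡⟨ cong (kn *_) ([m*n]^k≡m^k*n^k (3 ^ 9 * n * (u + m) ^ 8) (m ^ 20) s) ⟨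
  kn * (3 ^ 9 * n * (u + m) ^ 8 * m ^ 20) ^ s
    ≤⟨ scale-powers kn _ _ (A₀ * s ^ 11) (B₀ * n ^ 11) s 0<B₀n¹¹
         (base-inequality u n s 100s≤n 2n≤3u) (tail-estimate K n s 0<s 100s≤n th≤n) ⟩
  (u ^ 20 * (s * m ^ 8)) ^ s
    ≡⟨ [m*n]^k≡m^k*n^k (u ^ 20) (s * m ^ 8) s ⟩
  (u ^ 20) ^ s * (s * m ^ 8) ^ s ∎)
  where
  open ≤-Reasoning
  m kn : ℕ
  m = 8 * s
  kn = K * suc n
  0<sm⁸ : 0 < s * m ^ 8
  0<sm⁸ = *-mono-≤ 0<s (^>0 8 (≤-trans 0<s (m≤n*m s 8)))
  0<B₀n¹¹ : 0 < B₀ * n ^ 11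
  0<B₀n¹¹ = *-mono-≤ (≤ᵇ⇒≤ 1 B₀ _) (^>0 11 (≤-trans 0<s (≤-trans (m≤n*m s 100) 100s≤n)))
  regroup : ∀ a p k q → a * p * k * q ≡ k * (a * q * p)
  regroup = solve-∀

witness : {u w : ℕ} → ℕ → Vec (Subset u) w → Subset w → Bool
witness n c S = (1 ≤ᵇ ∣ S ∣) ∧ ((100 * ∣ S ∣ ≤ᵇ n) ∧ (∣ nbhd c S ∣ ≤ᵇ 8 * ∣ S ∣))

witnessCount : (n u w : ℕ) → Subset w → ℕ
witnessCount n u w S = ∑[ c ∈ configs u w ] 𝟙 (witness n c S)

witness-admissible : {u w : ℕ} (n : ℕ) (c : Vec (Subset u) w) (S : Subset w) →
  T (witness n c S) → 0 < ∣ S ∣ × 100 * ∣ S ∣ ≤ n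
witness-admissible n c S t with Equivalence.to T-∧ t
... | t₁ , t₂₃ = ≤ᵇ⇒≤ 1 ∣ S ∣ t₁ , ≤ᵇ⇒≤ (100 * ∣ S ∣) n (proj₁ (Equivalence.to T-∧ t₂₃))

witnessCount-inadmissible : (n u w : ℕ) (S : Subset w) →
  ¬ (0 < ∣ S ∣ × 100 * ∣ S ∣ ≤ n) → witnessCount n u w S ≡ 0
witnessCount-inadmissible n u w S ¬adm =
  trans (∑-cong (configs u w) (λ c → 𝟙-false (λ t → ¬adm (witness-admissible n c S t)))) (∑-zero (configs u w))

contained-in-small : (u m : ℕ) (X : Subset u) →
  𝟙 (∣ X ∣ ≤ᵇ m) ≤ ∑[ T ∈ subsets u ] (𝟙 (∣ T ∣ ≤ᵇ m) * 𝟙 (X ⊆ᵇ T))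
contained-in-small u m X = begin
  𝟙 (∣ X ∣ ≤ᵇ m)                                 ≡⟨ *-identityʳ _ ⟨
  𝟙 (∣ X ∣ ≤ᵇ m) * 1                             ≡⟨ cong (λ b → 𝟙 (∣ X ∣ ≤ᵇ m) * 𝟙 b) (⊆ᵇ-refl X) ⟨
  𝟙 (∣ X ∣ ≤ᵇ m) * 𝟙 (X ⊆ᵇ X)                    ≤⟨ term≤∑ (λ T → 𝟙 (∣ T ∣ ≤ᵇ m) * 𝟙 (X ⊆ᵇ T)) (∈-subsets X) ⟩
  ∑[ T ∈ subsets u ] (𝟙 (∣ T ∣ ≤ᵇ m) * 𝟙 (X ⊆ᵇ T)) ∎
  where open ≤-Reasoning

#nbhd-⊆-bound : (u w m : ℕ) (T : Subset u) (S : Subset w) → ∣ T ∣ ≤ m →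
  weight (∣ T ∣ C 20) (u C 20) S * (u ^ 20) ^ ∣ S ∣ ≤ (u C 20) ^ w * (m ^ 20) ^ ∣ S ∣
#nbhd-⊆-bound u w m T S t≤m =
  ≤-trans (weight-bound (∣ T ∣ C 20) (u C 20) (∣ T ∣ ^ 20) (u ^ 20) S (C-ratio 20 ∣ T ∣ u (∣p∣≤n T)))
    (*-monoʳ-≤ ((u C 20) ^ w) (^-monoˡ-≤ ∣ S ∣ (^-monoˡ-≤ 20 t≤m)))

small-nbhd-bound : (u w m : ℕ) (S : Subset w) →
  ∑[ c ∈ configs u w ] 𝟙 (∣ nbhd c S ∣ ≤ᵇ m) * (u ^ 20) ^ ∣ S ∣ ≤
  atMost u m * ((u C 20) ^ w * (m ^ 20) ^ ∣ S ∣)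
small-nbhd-bound u w m S = begin
  ∑[ c ∈ CF ] 𝟙 (∣ nbhd c S ∣ ≤ᵇ m) * Z
    ≤⟨ *-monoˡ-≤ Z (∑-mono CF (λ c → contained-in-small u m (nbhd c S))) ⟩
  ∑[ c ∈ CF ] ∑[ T ∈ SU ] (𝟙 (∣ T ∣ ≤ᵇ m) * 𝟙 (nbhd c S ⊆ᵇ T)) * Z
    ≡⟨ cong (_* Z) (∑-swap CF SU (λ c T → 𝟙 (∣ T ∣ ≤ᵇ m) * 𝟙 (nbhd c S ⊆ᵇ T))) ⟩
  ∑[ T ∈ SU ] ∑[ c ∈ CF ] (𝟙 (∣ T ∣ ≤ᵇ m) * 𝟙 (nbhd c S ⊆ᵇ T)) * Z
    ≡⟨ cong (_* Z) (∑-cong SU (λ T → trans (∑-*ˡ CF (𝟙 (∣ T ∣ ≤ᵇ m)) (λ c → 𝟙 (nbhd c S ⊆ᵇ T)))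
         (cong (𝟙 (∣ T ∣ ≤ᵇ m) *_) (#nbhd-⊆ u w T S)))) ⟩
  ∑[ T ∈ SU ] (𝟙 (∣ T ∣ ≤ᵇ m) * weight (∣ T ∣ C 20) (u C 20) S) * Z
    ≡⟨ ∑-*ʳ SU Z _ ⟨
  ∑[ T ∈ SU ] (𝟙 (∣ T ∣ ≤ᵇ m) * weight (∣ T ∣ C 20) (u C 20) S * Z)
    ≡⟨ ∑-cong SU (λ T → *-assoc (𝟙 (∣ T ∣ ≤ᵇ m)) _ Z) ⟩
  ∑[ T ∈ SU ] (𝟙 (∣ T ∣ ≤ᵇ m) * (weight (∣ T ∣ C 20) (u C 20) S * Z))
    ≤⟨ ∑-mono SU (λ T → guarded-mono (∣ T ∣ ≤ᵇ m) (λ t → #nbhd-⊆-bound u w m T S (≤ᵇ⇒≤ ∣ T ∣ m t))) ⟩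
  ∑[ T ∈ SU ] (𝟙 (∣ T ∣ ≤ᵇ m) * ((u C 20) ^ w * (m ^ 20) ^ ∣ S ∣))
    ≡⟨ ∑-*ʳ SU _ (λ T → 𝟙 (∣ T ∣ ≤ᵇ m)) ⟩
  atMost u m * ((u C 20) ^ w * (m ^ 20) ^ ∣ S ∣) ∎
  where
  open ≤-Reasoning
  Z : ℕ
  Z = (u ^ 20) ^ ∣ S ∣
  CF : List (Vec (Subset u) w)
  CF = configs u w
  SU : List (Subset u)
  SU = subsets u

witness-bound : (n u w : ℕ) (S : Subset w) →
  witnessCount n u w S * (u ^ 20) ^ ∣ S ∣ ≤ atMost u (8 * ∣ S ∣) * ((u C 20) ^ w * ((8 * ∣ S ∣) ^ 20) ^ ∣ S ∣)
witness-bound n u w S = ≤-trans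
  (*-monoˡ-≤ ((u ^ 20) ^ ∣ S ∣) (∑-mono (configs u w) (λ c →
    ≤-trans (𝟙-∧ʳ (1 ≤ᵇ ∣ S ∣) _) (𝟙-∧ʳ (100 * ∣ S ∣ ≤ᵇ n) _))))
  (small-nbhd-bound u w (8 * ∣ S ∣) S)

sizeClass : (n u w s : ℕ) → ℕ
sizeClass n u w s = ∑[ S ∈ subsets w ] (𝟙 (∣ S ∣ ≡ᵇ s) * witnessCount n u w S)

sizeClass-inadmissible : ∀ n u w s → ¬ (0 < s × 100 * s ≤ n) → sizeClass n u w s ≡ 0
sizeClass-inadmissible n u w s ¬adm = n≤0⇒n≡0 (begin
  sizeClass n u w s
    ≤⟨ ∑-mono (subsets w) (λ S → guarded-mono (∣ S ∣ ≡ᵇ s) (λ t → ≤-reflexive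
         (witnessCount-inadmissible n u w S (λ adm → ¬adm (subst (λ x → 0 < x × 100 * x ≤ n) (≡ᵇ⇒≡ ∣ S ∣ s t) adm))))) ⟩
  ∑[ S ∈ subsets w ] (𝟙 (∣ S ∣ ≡ᵇ s) * 0)
    ≡⟨ trans (∑-cong (subsets w) (λ S → *-zeroʳ (𝟙 (∣ S ∣ ≡ᵇ s)))) (∑-zero (subsets w)) ⟩
  0 ∎)
  where open ≤-Reasoning

sizeClass-admissible : ∀ K n u w s → 0 < s → 100 * s ≤ n → 2 * n ≤ 3 * u → w ≤ n → threshold K ≤ n →
  sizeClass n u w s * (K * suc n) ≤ (u C 20) ^ w
sizeClass-admissible K n u w s 0<s 100s≤n 2n≤3u w≤n th≤n = *-cancelʳ-≤-pos _ _ Z (^>0 s (^>0 20 0<u)) (begin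
  sizeClass n u w s * kn * Z
    ≡⟨ swap₂₃ (sizeClass n u w s) kn Z ⟩
  ∑[ S ∈ subsets w ] (𝟙 (∣ S ∣ ≡ᵇ s) * witnessCount n u w S) * Z * kn
    ≡⟨ cong (_* kn) (trans (∑-cong (subsets w) (λ S → sym (*-assoc (𝟙 (∣ S ∣ ≡ᵇ s)) _ Z))) (∑-*ʳ (subsets w) Z _)) ⟨
  ∑[ S ∈ subsets w ] (𝟙 (∣ S ∣ ≡ᵇ s) * (witnessCount n u w S * Z)) * kn
    ≤⟨ *-monoˡ-≤ kn (∑-mono (subsets w) (λ S → guarded-mono (∣ S ∣ ≡ᵇ s) (λ t →
         subst (λ x → witnessCount n u w S * (u ^ 20) ^ x ≤ atMost u (8 * x) * ((u C 20) ^ w * ((8 * x) ^ 20) ^ x))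
           (≡ᵇ⇒≡ ∣ S ∣ s t) (witness-bound n u w S)))) ⟩
  ∑[ S ∈ subsets w ] (𝟙 (∣ S ∣ ≡ᵇ s) * R) * kn
    ≡⟨ cong (_* kn) (trans (∑-*ʳ (subsets w) R _) (cong (_* R) (count-size w s))) ⟩
  (w C s) * R * kn
    ≡⟨ regroup (w C s) (atMost u m) ((u C 20) ^ w) ((m ^ 20) ^ s) kn ⟩
  (w C s) * atMost u m * (m ^ 20) ^ s * kn * (u C 20) ^ w
    ≤⟨ *-monoˡ-≤ ((u C 20) ^ w) (term-estimate K u w n s 0<s 100s≤n 2n≤3u w≤n th≤n) ⟩
  Z * (u C 20) ^ w
    ≡⟨ *-comm Z ((u C 20) ^ w) ⟩
  (u C 20) ^ w * Z ∎)
  where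
  open ≤-Reasoning
  m kn Z R : ℕ
  m = 8 * s
  kn = K * suc n
  Z = (u ^ 20) ^ s
  R = atMost u m * ((u C 20) ^ w * (m ^ 20) ^ s)
  0<u : 0 < u
  0<u = positive u (≤-trans 0<s (≤-trans (m≤n*m s 100) 100s≤n)) 2n≤3u
    where
    positive : ∀ v → 0 < n → 2 * n ≤ 3 * v → 0 < v
    positive zero 0<n 2n≤0 = ⊥-elim (<⇒≱ (*-monoʳ-< 2 0<n) 2n≤0)
    positive (suc v) _ _ = z<s
  swap₂₃ : ∀ a b c → a * b * c ≡ a * c * b
  swap₂₃ = solve-∀
  regroup : ∀ c a t q k → c * (a * (t * q)) * k ≡ c * a * q * k * t
  regroup = solve-∀

sizeClass-bound : ∀ K n u w s → 2 * n ≤ 3 * u → w ≤ n → threshold K ≤ n →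
  sizeClass n u w s * (K * suc n) ≤ (u C 20) ^ w
sizeClass-bound K n u w s 2n≤3u w≤n th≤n with (0 <? s) ×-dec (100 * s ≤? n)
... | yes (0<s , 100s≤n) = sizeClass-admissible K n u w s 0<s 100s≤n 2n≤3u w≤n th≤n
... | no ¬adm = ≤-trans (≤-reflexive (cong (_* (K * suc n)) (sizeClass-inadmissible n u w s ¬adm))) z≤n

split-by-size : (w : ℕ) (f : Subset w → ℕ) →
  ∑ (subsets w) f ≤ ∑[ s ∈ upTo (suc w) ] ∑[ S ∈ subsets w ] (𝟙 (∣ S ∣ ≡ᵇ s) * f S)
split-by-size w f = ≤-trans (∑-mono (subsets w) own-size)
  (≤-reflexive (∑-swap (subsets w) (upTo (suc w)) (λ S s → 𝟙 (∣ S ∣ ≡ᵇ s) * f S)))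
  where
  own-size : (S : Subset w) → f S ≤ ∑[ s ∈ upTo (suc w) ] (𝟙 (∣ S ∣ ≡ᵇ s) * f S)
  own-size S = ≤-trans
    (≤-reflexive (sym (trans (cong (_* f S) (𝟙-true (≡⇒≡ᵇ ∣ S ∣ ∣ S ∣ refl))) (*-identityˡ (f S)))))
    (term≤∑ (λ s → 𝟙 (∣ S ∣ ≡ᵇ s) * f S) (∈-upTo⁺ (s≤s (∣p∣≤n S))))

badCount≤∑sizeClass : (n u w : ℕ) → badCount u w n ≤ ∑[ s ∈ upTo (suc w) ] sizeClass n u w s
badCount≤∑sizeClass n u w = begin
  badCount u w n
    ≤⟨ ∑-mono (configs u w) (λ c → 𝟙-any≤∑ (witness n c) (subsets w)) ⟩
  ∑[ c ∈ configs u w ] ∑[ S ∈ subsets w ] 𝟙 (witness n c S)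
    ≡⟨ ∑-swap (configs u w) (subsets w) (λ c S → 𝟙 (witness n c S)) ⟩
  ∑[ S ∈ subsets w ] witnessCount n u w S
    ≤⟨ split-by-size w (witnessCount n u w) ⟩
  ∑[ s ∈ upTo (suc w) ] sizeClass n u w s ∎
  where open ≤-Reasoning

bad-fraction : ∀ K n u w → 2 * n ≤ 3 * u → w ≤ n → threshold K ≤ n →
  badCount u w n * K ≤ length (configs u w)
bad-fraction K n u w 2n≤3u w≤n th≤n = *-cancelʳ-≤-pos _ _ (suc n) z<s (begin
  badCount u w n * K * suc n
    ≡⟨ *-assoc (badCount u w n) K (suc n) ⟩
  badCount u w n * (K * suc n)
    ≤⟨ *-monoˡ-≤ (K * suc n) (badCount≤∑sizeClass n u w) ⟩
  ∑[ s ∈ upTo (suc w) ] sizeClass n u w s * (K * suc n)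
    ≡⟨ ∑-*ʳ (upTo (suc w)) (K * suc n) (sizeClass n u w) ⟨
  ∑[ s ∈ upTo (suc w) ] (sizeClass n u w s * (K * suc n))
    ≤⟨ ∑-mono (upTo (suc w)) (λ s → sizeClass-bound K n u w s 2n≤3u w≤n th≤n) ⟩
  ∑[ s ∈ upTo (suc w) ] ((u C 20) ^ w)
    ≡⟨ trans (∑-const (upTo (suc w)) _) (cong (_* (u C 20) ^ w) (length-upTo (suc w))) ⟩
  suc w * (u C 20) ^ w
    ≤⟨ *-monoˡ-≤ ((u C 20) ^ w) (s≤s w≤n) ⟩
  suc n * (u C 20) ^ w
    ≡⟨ cong (suc n *_) (trans (length≡∑1 (configs u w)) (#configs u w)) ⟨
  suc n * length (configs u w)
    ≡⟨ *-comm (suc n) _ ⟩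
  length (configs u w) * suc n ∎)
  where open ≤-Reasoning

lemma2p7 : (u w : ℕ → ℕ) → (∀ n → 2 * n ≤ 3 * u n) → (∀ n → w n ≤ n) →
    ∀ k → ∃[ N ] (∀ n → N ≤ n →
    badCount (u n) (w n) n * suc k ≤ length (configs (u n) (w n)))
lemma2p7 u w 2n≤3u w≤n k =
  threshold (suc k) , λ n th≤n → bad-fraction (suc k) n (u n) (w n) (2n≤3u n) (w≤n n) th≤n
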